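{- Let $G$ be an embedded simple graph and $V_c$ a cutset of $G$. If $C_1,C_2$ are different $G_b$-bridges of $\bar G_b$, then they are in different faces of $G_b$; that is, no face of $G_b$ has two different $G_b$-bridges of $\bar G_b$ inside it.
   Context: An embedded graph is a connected graph with a combinatorial embedding in an orientable surface: each edge $\{v,w\}$ gives directed edges $(v,w),(w,v)$, each vertex has a cyclic rotational order of its outgoing directed edges, and faces are cyclic sequences $(v_0,v_1),\dots,(v_{k-1},v_0)$ of pairwise different directed edges with $(v_{i+1},v_{i+2})$ following $(v_{i+1},v_i)$ at $v_{i+1}$; the pair $(v_{i+1},v_i),(v_{i+1},v_{i+2})$ is an angle. For a cutset $V_c$: $F_b$ is the set of faces $(v_0,v_1),\dots,(v_{k-1},v_0)$ with indices $0\le i<j\le k-1$ such that $v_i,v_j\in V_c$ ($v_i=v_j$ allowed); $G_b$ is the bipartite multigraph on $V_c\cup F_b$ with one edge $\{v,f\}$ for each occurrence of $v\in V_c$ in the boundary walk of $f\in F_b$; $\bar G_b=G\cup G_b$ is embedded so that at each $v\in V_c$ the edges to $F_b$ are placed in the angles of the corresponding faces and the rotation at $f\in F_b$ follows its boundary walk; $G_b$ carries the induced embedding. A $G_b$-bridge of $\bar G_b$ is either an edge of $\bar G_b$ not in $G_b$ with both ends in $G_b$, or a component of $\bar G_b-V(G_b)$ together with its edges to $G_b$ and their endpoints. A bridge is inside a face $f$ of $G_b$ if one of its edges lies between the two edges of an angle of $f$ in the rotation at that vertex. -}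

module Defs where

open import Data.Nat using (ℕ)
open import Data.Fin using (Fin)
open import Data.Fin.Subset using (Subset; _∈_; _∉_)
open import Data.Bool using (Bool; true; false; not)
open import Data.Sum using (_⊎_; inj₁; inj₂)
open import Data.Product using (Σ; ∃; ∃-syntax; _×_; _,_)
open import Data.Empty using (⊥)
open import Relation.Nullary using (¬_)
open import Relation.Binary.PropositionalEquality using (_≡_; _≢_)
open import Relation.Binary.Construct.Closure.ReflexiveTransitive using (Star)

-- Embedded graphs as rotation systems on darts (directed edges).
-- Vertices : Fin n, darts (directed edges) : Fin m.
-- tail d  : start vertex of dart d,   rev d : the reversed dart,
-- rot d   : the dart following d in the cyclic rotation at tail d.

record EmbeddedGraph (n m : ℕ) : Set where
  field
    tail      : Fin m → Fin n
    rev       : Fin m → Fin m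
    rot       : Fin m → Fin m
    rev-invol : ∀ d → rev (rev d) ≡ d
    rev-nofix : ∀ d → rev d ≢ d
    rot-inj   : ∀ d e → rot d ≡ rot e → d ≡ e
    rot-tail  : ∀ d → tail (rot d) ≡ tail d
    rot-cyclic : ∀ d e → tail d ≡ tail e → Star (λ x y → rot x ≡ y) d e

  head : Fin m → Fin n
  head d = tail (rev d)

  Adj : Fin n → Fin n → Set
  Adj u v = ∃[ d ] (tail d ≡ u × head d ≡ v)

  -- face successor: (v_i,v_{i+1}) is followed by (v_{i+1},v_{i+2}),
  -- which follows (v_{i+1},v_i) in the rotation at v_{i+1}
  Next : Fin m → Fin m → Set
  Next d e = rot (rev d) ≡ e

  SameFace : Fin m → Fin m → Set
  SameFace = Star Next

open EmbeddedGraph public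

Connected : ∀ {n m} → EmbeddedGraph n m → Set
Connected G = ∀ u v → Star (Adj G) u v

Simple : ∀ {n m} → EmbeddedGraph n m → Set
Simple G = (∀ d → head G d ≢ tail G d)
         × (∀ d e → tail G d ≡ tail G e → head G d ≡ head G e → d ≡ e)

data Avoid {A : Set} (R : A → A → Set) (P : A → Set) : A → A → Set where
  stop : ∀ {x y} → R x y → P y → Avoid R P x y
  skip : ∀ {x z y} → R x z → ¬ P z → Avoid R P z y → Avoid R P x y

data PathNot {A : Set} (R : A → A → Set) (P : A → Set) : A → A → Set where
  one  : ∀ {x y} → R x y → ¬ P y → PathNot R P x y
  more : ∀ {x z y} → R x z → ¬ P z → PathNot R P z y → PathNot R P x y

module _ {n m : ℕ} (G : EmbeddedGraph n m) (Vc : Subset n) where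

  AdjOut : Fin n → Fin n → Set
  AdjOut u v = u ∉ Vc × v ∉ Vc × Adj G u v

  ConnOut : Fin n → Fin n → Set
  ConnOut = Star AdjOut

  Cutset : Set
  Cutset = ∃[ u ] ∃[ v ] (u ∉ Vc × v ∉ Vc × ¬ ConnOut u v)

  -- the face of dart d is in F_b: its boundary walk has two different
  -- positions i < j with v_i , v_j ∈ Vc (v_i = v_j allowed); positions of
  -- a face are its (pairwise different) darts, v_i being the tail.
  InFb : Fin m → Set
  InFb d = ∃[ e ] ∃[ e' ] (SameFace G d e × SameFace G d e' × e ≢ e'
                           × tail G e ∈ Vc × tail G e' ∈ Vc)

  -- occurrences of v ∈ Vc in boundary walks of faces in F_b, indexed by
  -- the dart d = (v , v_{i+1}) of the walk leaving that occurrence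
  Occ : Fin m → Set
  Occ d = tail G d ∈ Vc × InFb d

  NextOcc : Fin m → Fin m → Set
  NextOcc = Avoid (Next G) (λ e → tail G e ∈ Vc)

  -- The embedded graph  Ḡ_b = G ∪ G_b.
  -- Darts: inj₁ g  (g a dart of G)
  --        inj₂ (d , true)   the G_b dart  v → f  for occurrence d
  --        inj₂ (d , false)  the G_b dart  f → v  for occurrence d
  Dart : Set
  Dart = Fin m ⊎ (Fin m × Bool)

  IsGb : Dart → Set
  IsGb (inj₁ _)       = ⊥
  IsGb (inj₂ (d , _)) = Occ d

  revB : Dart → Dart
  revB (inj₁ g)       = inj₁ (rev G g)
  revB (inj₂ (d , b)) = inj₂ (d , not b)

  data RotB : Dart → Dart → Set where
    -- at v ∈ Vc: the edge v f of occurrence d lies in the angle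
    -- ((v,v_{i-1}) , d), i.e. directly before d
    occ→g  : ∀ {d} → Occ d → RotB (inj₂ (d , true)) (inj₁ d)
    g→occ  : ∀ {g} → Occ (rot G g) → RotB (inj₁ g) (inj₂ (rot G g , true))
    g→g    : ∀ {g} → ¬ Occ (rot G g) → RotB (inj₁ g) (inj₁ (rot G g))
    -- at f ∈ F_b: the rotation follows the boundary walk (placing f inside
    -- the face; in the orientation of rot this lists the occurrences in
    -- reverse walk order)
    atFace : ∀ {d d'} → Occ d → Occ d' → NextOcc d' d
           → RotB (inj₂ (d , false)) (inj₂ (d' , false))

  RotGb : Dart → Dart → Set
  RotGb = Avoid RotB IsGb

  NextGb : Dart → Dart → Set
  NextGb x y = RotGb (revB x) y

  SameFaceGb : Dart → Dart → Set
  SameFaceGb = Star NextGb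

  Between : Dart → Dart → Dart → Set
  Between a g b = PathNot RotB IsGb a g × Avoid RotB IsGb g b

  -- G_b-bridges of Ḡ_b.  Since V(G_b) = Vc ∪ F_b and F_b-vertices are only
  -- adjacent to Vc, the bridges are: edges of G with both ends in Vc, and
  -- components of G - Vc with their edges to Vc.
  data Bridge : Set where
    edgeB : Fin m → Bridge   -- the edge of dart d
    compB : Fin n → Bridge   -- the component of G - Vc containing u

  IsBridge : Bridge → Set
  IsBridge (edgeB d) = tail G d ∈ Vc × head G d ∈ Vc
  IsBridge (compB u) = u ∉ Vc

  SameBridge : Bridge → Bridge → Set
  SameBridge (edgeB d) (edgeB e) = e ≡ d ⊎ e ≡ rev G d
  SameBridge (compB u) (compB v) = ConnOut u v
  SameBridge _ _ = ⊥

  EdgeAt : Bridge → Fin m → Set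
  EdgeAt (edgeB d) g = g ≡ d ⊎ g ≡ rev G d
  EdgeAt (compB u) g = tail G g ∈ Vc × head G g ∉ Vc × ConnOut (head G g) u

  -- bridge C is inside the face of G_b containing the G_b dart x:
  -- some edge of C lies between the two edges of an angle
  -- (revB a , b) of that face (b follows a on the face)
  Inside : Bridge → Dart → Set
  Inside C x = ∃[ a ] ∃[ b ] ∃[ g ]
                 (SameFaceGb x a × NextGb a b × EdgeAt C g
                  × Between (revB a) (inj₁ g) b)

-- Every G_b-dart x of a face of G_b determines a bridge: the bridge of the G-darts in the
-- angle of G_b next to x.  This bridge is constant along the face of G_b.  Inside an angle
-- at v ∈ Vc, two consecutive G-darts with no G_b-edge between them bound a face of G that
-- meets Vc only at v (it is not in F_b), so its boundary walk joins their far ends in G − Vc.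
-- Across a face vertex f ∈ F_b, the G-darts flanking the angle at f are joined by the
-- boundary walk of f between two consecutive occurrences of Vc, which stays in G − Vc or is
-- a single edge between vertices of Vc.  Hence every bridge inside a face of G_b is the
-- bridge of that face.
module Submission where

open import Defs
open import Data.Bool using (true; false)
open import Data.Empty using (⊥; ⊥-elim)
open import Data.Fin using (Fin; toℕ; _≟_)
open import Data.Fin.Properties using (pigeonhole)
open import Data.Fin.Subset using (Subset; _∈_; _∉_)
open import Data.Fin.Subset.Properties using (_∈?_)
open import Data.Nat using (ℕ; zero; suc; _<_; s≤s)
open import Data.Nat.Properties using (n<1+n)
open import Data.Product using (∃-syntax; _×_; _,_; proj₁; proj₂)
open import Data.Sum using (_⊎_; inj₁; inj₂)
open import Function.Definitions using (Injective)
open import Relation.Nullary using (¬_; Dec; yes; no)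
open import Relation.Binary.PropositionalEquality
open import Relation.Binary.Construct.Closure.ReflexiveTransitive
  using (Star; ε; _◅_; _◅◅_; reverse)

Star-unsnoc : ∀ {A : Set} {R : A → A → Set} {x y} → Star R x y → x ≡ y ⊎ ∃[ z ] R z y
Star-unsnoc ε = inj₁ refl
Star-unsnoc (r ◅ rs) with Star-unsnoc rs
... | inj₁ refl = inj₂ (_ , r)
... | inj₂ last = inj₂ last

Star-preserves : ∀ {A : Set} {R : A → A → Set} (P : A → Set)
               → (∀ {a b} → R a b → P a → P b) → ∀ {a b} → Star R a b → P a → P b
Star-preserves P step ε        pa = pa
Star-preserves P step (r ◅ rs) pa = Star-preserves P step rs (step r pa)

module InjectiveEndo {m : ℕ} {f : Fin m → Fin m} (f-injective : Injective _≡_ _≡_ f) where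

  Step : Fin m → Fin m → Set
  Step a b = f a ≡ b

  iterate : ℕ → Fin m → Fin m
  iterate zero    y = y
  iterate (suc k) y = f (iterate k y)

  iterate-Star : ∀ k y → Star Step y (iterate k y)
  iterate-Star zero    y = ε
  iterate-Star (suc k) y = iterate-Star k y ◅◅ (refl ◅ ε)

  iterate-period : ∀ {i j} y → i < j → iterate i y ≡ iterate j y → ∃[ k ] y ≡ iterate (suc k) y
  iterate-period {zero}  {suc k} y _         eq = k , eq
  iterate-period {suc i} {suc j} y (s≤s i<j) eq = iterate-period y i<j (f-injective eq)

  orbit-returns : ∀ x → Star Step (f x) x
  orbit-returns x
    with i , j , i<j , eq ← pigeonhole (n<1+n m) (λ i → iterate (toℕ i) (f x))
    with k , period ← iterate-period (f x) i<j eq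
    = subst (Star Step (f x)) (sym (f-injective period)) (iterate-Star k (f x))

module _ {n m : ℕ} (G : EmbeddedGraph n m) where

  rev-injective : Injective _≡_ _≡_ (rev G)
  rev-injective {a} {b} eq = trans (sym (rev-invol G a)) (trans (cong (rev G) eq) (rev-invol G b))

  head-rev : ∀ d → head G (rev G d) ≡ tail G d
  head-rev d = cong (tail G) (rev-invol G d)

  faceSucc : Fin m → Fin m
  faceSucc d = rot G (rev G d)

  face-returns : ∀ d → SameFace G (faceSucc d) d
  face-returns = InjectiveEndo.orbit-returns (λ eq → rev-injective (rot-inj G _ _ eq))

  Next⇒head≡tail : ∀ {d e} → Next G d e → head G d ≡ tail G e
  Next⇒head≡tail {d} refl = sym (rot-tail G (rev G d))

  rot-surjective : ∀ d → ∃[ z ] rot G z ≡ d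
  rot-surjective d with Star-unsnoc (rot-cyclic G (rot G d) d (rot-tail G d))
  ... | inj₁ rot-fixed = d , rot-fixed
  ... | inj₂ last      = last

  rot⁻¹ : Fin m → Fin m
  rot⁻¹ d = proj₁ (rot-surjective d)

  rot⁻¹-rot : ∀ d → rot⁻¹ (rot G d) ≡ d
  rot⁻¹-rot d = rot-inj G _ _ (proj₂ (rot-surjective (rot G d)))

  Next⇒rot⁻¹ : ∀ {d e} → Next G d e → rot⁻¹ e ≡ rev G d
  Next⇒rot⁻¹ {d} refl = rot⁻¹-rot (rev G d)

  module _ (loopless : ∀ d → head G d ≢ tail G d) where

    faceSucc-≢ : ∀ d → faceSucc d ≢ d
    faceSucc-≢ d eq = loopless d (trans (sym (rot-tail G (rev G d))) (cong (tail G) eq))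

    rev-≢-rot : ∀ d → rev G d ≢ rot G d
    rev-≢-rot d eq = loopless d (trans (cong (tail G) eq) (rot-tail G d))

module _ {n m : ℕ} (G : EmbeddedGraph n m) (Vc : Subset n) where

  infix 4 _≈_
  _≈_ : Bridge G Vc → Bridge G Vc → Set
  _≈_ = SameBridge G Vc

  ConnOut-sym : ∀ {u v} → ConnOut G Vc u v → ConnOut G Vc v u
  ConnOut-sym = reverse λ { (u∉ , v∉ , d , tail≡u , head≡v) →
    v∉ , u∉ , rev G d , head≡v , trans (head-rev G d) tail≡u }

  ≈-refl : ∀ {C} → C ≈ C
  ≈-refl {edgeB d} = inj₁ refl
  ≈-refl {compB u} = ε

  ≈-sym : ∀ {C D} → C ≈ D → D ≈ C
  ≈-sym {edgeB d} {edgeB .d}          (inj₁ refl) = inj₁ refl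
  ≈-sym {edgeB d} {edgeB .(rev G d)} (inj₂ refl) = inj₂ (sym (rev-invol G d))
  ≈-sym {compB u} {compB v}          c           = ConnOut-sym c

  ≈-trans : ∀ {C D E} → C ≈ D → D ≈ E → C ≈ E
  ≈-trans {edgeB d} {edgeB .d}         {edgeB e}  (inj₁ refl) q           = q
  ≈-trans {edgeB d} {edgeB .(rev G d)} {edgeB ._} (inj₂ refl) (inj₁ refl) = inj₂ refl
  ≈-trans {edgeB d} {edgeB .(rev G d)} {edgeB ._} (inj₂ refl) (inj₂ refl) = inj₁ (rev-invol G d)
  ≈-trans {compB u} {compB v}          {compB w}  p           q           = p ◅◅ q

  -- Meaningful only for darts leaving a vertex of Vc.
  bridgeOf : Fin m → Bridge G Vc
  bridgeOf g with head G g ∈? Vc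
  ... | yes _ = edgeB g
  ... | no  _ = compB (head G g)

  bridgeOf-edge : ∀ g → head G g ∈ Vc → bridgeOf g ≡ edgeB g
  bridgeOf-edge g g∈ with head G g ∈? Vc
  ... | yes _  = refl
  ... | no  g∉ = ⊥-elim (g∉ g∈)

  bridgeOf-comp : ∀ g → head G g ∉ Vc → bridgeOf g ≡ compB (head G g)
  bridgeOf-comp g g∉ with head G g ∈? Vc
  ... | yes g∈ = ⊥-elim (g∉ g∈)
  ... | no  _  = refl

  bridgeOf-rev : ∀ g → tail G g ∈ Vc → head G g ∈ Vc → bridgeOf g ≈ bridgeOf (rev G g)
  bridgeOf-rev g tail∈ head∈ =
    subst₂ _≈_ (sym (bridgeOf-edge g head∈))
               (sym (bridgeOf-edge (rev G g) (subst (_∈ Vc) (sym (head-rev G g)) tail∈)))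
               (inj₂ refl)

  bridgeOf-ConnOut : ∀ g g' → head G g ∉ Vc → head G g' ∉ Vc
                   → ConnOut G Vc (head G g) (head G g') → bridgeOf g ≈ bridgeOf g'
  bridgeOf-ConnOut g g' g∉ g'∉ =
    subst₂ _≈_ (sym (bridgeOf-comp g g∉)) (sym (bridgeOf-comp g' g'∉))

  EdgeAt⇒≈bridgeOf : ∀ {C g} → IsBridge G Vc C → EdgeAt G Vc C g → C ≈ bridgeOf g
  EdgeAt⇒≈bridgeOf {edgeB d} (_ , head∈) (inj₁ refl) =
    subst (edgeB d ≈_) (sym (bridgeOf-edge d head∈)) (inj₁ refl)
  EdgeAt⇒≈bridgeOf {edgeB d} (tail∈ , _) (inj₂ refl) =
    subst (edgeB d ≈_) (sym (bridgeOf-edge (rev G d) (subst (_∈ Vc) (sym (head-rev G d)) tail∈)))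
          (inj₂ refl)
  EdgeAt⇒≈bridgeOf {compB u} {g} _ (_ , head∉ , c) =
    subst (compB u ≈_) (sym (bridgeOf-comp g head∉)) (ConnOut-sym c)

  NextOcc⇒ConnOut : ∀ {w d} → NextOcc G Vc w d → tail G w ∉ Vc
                → ∃[ y ] (Next G y d × tail G y ∉ Vc × ConnOut G Vc (tail G w) (tail G y))
  NextOcc⇒ConnOut {w} (stop s _) w∉ = w , s , w∉ , ε
  NextOcc⇒ConnOut {w} (skip s w'∉ rest) w∉
    with y , s' , y∉ , c ← NextOcc⇒ConnOut rest w'∉
    = y , s' , y∉ , (w∉ , w'∉ , w , refl , Next⇒head≡tail G s) ◅ c

  -- A face of G outside F_b meets Vc at most once; its boundary walk from the
  -- occurrence h onwards therefore stays in one component of G − Vc.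
  module FaceMeetingVcOnce {h : Fin m} (h∈ : tail G h ∈ Vc) (h-notOcc : ¬ Occ G Vc h) where

    off-Vc : ∀ {w} → SameFace G h w → w ≢ h → tail G w ∉ Vc
    off-Vc {w} h~w w≢h w∈ = h-notOcc (h∈ , h , w , ε , h~w , (λ eq → w≢h (sym eq)) , h∈ , w∈)

    Reached : Fin m → Set
    Reached y = SameFace G h y × (y ≡ h ⊎ tail G y ∉ Vc × ConnOut G Vc (head G h) (tail G y))

    Reached-step : ∀ {y y'} → Next G y y' → Reached y → Reached y'
    Reached-step {y} {y'} s (h~y , r) = h~y' , status (y' ≟ h)
      where
      h~y' : SameFace G h y'
      h~y' = h~y ◅◅ (s ◅ ε)
      extend : tail G y' ∉ Vc → y ≡ h ⊎ tail G y ∉ Vc × ConnOut G Vc (head G h) (tail G y)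
             → ConnOut G Vc (head G h) (tail G y')
      extend _   (inj₁ refl)     = subst (ConnOut G Vc (head G h)) (Next⇒head≡tail G s) ε
      extend y'∉ (inj₂ (y∉ , c)) = c ◅◅ ((y∉ , y'∉ , y , refl , Next⇒head≡tail G s) ◅ ε)
      status : Dec (y' ≡ h) → y' ≡ h ⊎ tail G y' ∉ Vc × ConnOut G Vc (head G h) (tail G y')
      status (yes y'≡h) = inj₁ y'≡h
      status (no  y'≢h) = inj₂ (off-Vc h~y' y'≢h , extend (off-Vc h~y' y'≢h) r)

    ConnOut-along-face : ∀ {x} → SameFace G h x → x ≢ h → ConnOut G Vc (head G h) (tail G x)
    ConnOut-along-face h~x x≢h with Star-preserves Reached Reached-step h~x (ε , inj₁ refl)
    ... | _ , inj₁ x≡h       = ⊥-elim (x≢h x≡h)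
    ... | _ , inj₂ (_ , c)   = c

  module _ (loopless : ∀ d → head G d ≢ tail G d) where

    bridgeOf-rot : ∀ z → tail G z ∈ Vc → ¬ Occ G Vc (rot G z) → bridgeOf (rot G z) ≈ bridgeOf z
    bridgeOf-rot z z∈ h-notOcc =
      bridgeOf-ConnOut h z h-head∉ z-head∉ (ConnOut-along-face h~z⁻ z⁻≢h)
      where
      h : Fin m
      h = rot G z
      h∈ : tail G h ∈ Vc
      h∈ = subst (_∈ Vc) (sym (rot-tail G z)) z∈
      open FaceMeetingVcOnce h∈ h-notOcc
      h~z⁻ : SameFace G h (rev G z)
      h~z⁻ = subst (λ w → SameFace G (rot G w) (rev G z)) (rev-invol G z) (face-returns G (rev G z))
      z⁻≢h : rev G z ≢ h
      z⁻≢h = rev-≢-rot G loopless z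
      h-head∉ : head G h ∉ Vc
      h-head∉ = subst (_∉ Vc) (sym (Next⇒head≡tail G refl))
                      (off-Vc (refl ◅ ε) (faceSucc-≢ G loopless h))
      z-head∉ : head G z ∉ Vc
      z-head∉ = off-Vc h~z⁻ z⁻≢h

    bridgeOf-NextOcc : ∀ {d' d} → tail G d' ∈ Vc → NextOcc G Vc d' d
                     → bridgeOf d' ≈ bridgeOf (rot⁻¹ G d)
    bridgeOf-NextOcc {d'} d'∈ (stop s d∈) =
      subst (λ z → bridgeOf d' ≈ bridgeOf z) (sym (Next⇒rot⁻¹ G s))
            (bridgeOf-rev d' d'∈ (subst (_∈ Vc) (sym (Next⇒head≡tail G s)) d∈))
    bridgeOf-NextOcc {d'} {d} _ (skip {z = w} s w∉ rest)
      with y , s' , y∉ , c ← NextOcc⇒ConnOut rest w∉ =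
      bridgeOf-ConnOut d' (rot⁻¹ G d) (subst (_∉ Vc) (sym d'-head) w∉)
                       (subst (_∉ Vc) (sym d-pred-head) y∉)
                       (subst₂ (ConnOut G Vc) (sym d'-head) (sym d-pred-head) c)
      where
      d'-head : head G d' ≡ tail G w
      d'-head = Next⇒head≡tail G s
      d-pred-head : head G (rot⁻¹ G d) ≡ tail G y
      d-pred-head = trans (cong (head G) (Next⇒rot⁻¹ G s')) (head-rev G y)

    bridgeOf-RotB : ∀ {g g'} → RotB G Vc (inj₁ g) (inj₁ g') → tail G g ∈ Vc
                  → tail G g' ∈ Vc × bridgeOf g' ≈ bridgeOf g
    bridgeOf-RotB {g} (g→g notOcc) g∈ =
      subst (_∈ Vc) (sym (rot-tail G g)) g∈ , bridgeOf-rot g g∈ notOcc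

    -- The G-darts of the angle of G_b which the face traversal passes through next to x
    -- lie in K: for f → v that angle at v begins with d, for v → f it ends with rot⁻¹ d.
    BridgeAt : Bridge G Vc → Dart G Vc → Set
    BridgeAt K (inj₁ _)           = ⊥
    BridgeAt K (inj₂ (d , false)) = bridgeOf d ≈ K
    BridgeAt K (inj₂ (d , true))  = bridgeOf (rot⁻¹ G d) ≈ K

    BridgeAt-exists : ∀ {x} → IsGb G Vc x → ∃[ K ] BridgeAt K x
    BridgeAt-exists {inj₂ (d , false)} _ = bridgeOf d , ≈-refl
    BridgeAt-exists {inj₂ (d , true)}  _ = bridgeOf (rot⁻¹ G d) , ≈-refl

    module _ {K : Bridge G Vc} where

      ending-angle : ∀ {g y} → Avoid (RotB G Vc) (IsGb G Vc) (inj₁ g) y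
                   → tail G g ∈ Vc → bridgeOf g ≈ K → BridgeAt K y
      ending-angle {g} (stop (g→occ _) _) _ g≈K =
        subst (λ z → bridgeOf z ≈ K) (sym (rot⁻¹-rot G g)) g≈K
      ending-angle (stop (g→g _) ())
      ending-angle (skip (g→occ occ) notGb _) _ _ = ⊥-elim (notGb occ)
      ending-angle (skip step@(g→g _) _ rest) g∈ g≈K
        with g'∈ , g'≈g ← bridgeOf-RotB step g∈ = ending-angle rest g'∈ (≈-trans g'≈g g≈K)

      inside-angle : ∀ {h g} → PathNot (RotB G Vc) (IsGb G Vc) (inj₁ h) (inj₁ g)
                   → tail G h ∈ Vc → bridgeOf h ≈ K → bridgeOf g ≈ K
      inside-angle (one step _) h∈ h≈K = ≈-trans (proj₂ (bridgeOf-RotB step h∈)) h≈K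
      inside-angle (more (g→occ occ) notGb _) _ _ = ⊥-elim (notGb occ)
      inside-angle (more step@(g→g _) _ rest) h∈ h≈K
        with h'∈ , h'≈h ← bridgeOf-RotB step h∈ = inside-angle rest h'∈ (≈-trans h'≈h h≈K)

      BridgeAt-NextGb : ∀ {a b} → NextGb G Vc a b → BridgeAt K a → BridgeAt K b
      BridgeAt-NextGb {inj₂ (d , false)} (stop (occ→g _) ())
      BridgeAt-NextGb {inj₂ (d , false)} (skip (occ→g occ) _ rest) d≈K =
        ending-angle rest (proj₁ occ) d≈K
      BridgeAt-NextGb {inj₂ (d , true)}  (stop (atFace _ occ' next) _) d≈K =
        ≈-trans (bridgeOf-NextOcc (proj₁ occ') next) d≈K
      BridgeAt-NextGb {inj₂ (d , true)}  (skip (atFace _ occ' _) notGb _) = ⊥-elim (notGb occ')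

      Between⇒≈ : ∀ {a g b} → BridgeAt K a → Between G Vc (revB G Vc a) (inj₁ g) b
                → bridgeOf g ≈ K
      Between⇒≈ {inj₂ (d , false)} d≈K (one (occ→g _) _ , _)         = d≈K
      Between⇒≈ {inj₂ (d , false)} d≈K (more (occ→g occ) _ rest , _) =
        inside-angle rest (proj₁ occ) d≈K
      Between⇒≈ {inj₂ (d , true)}  _   (more (atFace _ occ' _) notGb _ , _) = ⊥-elim (notGb occ')

      Inside⇒≈ : ∀ {C x} → IsBridge G Vc C → BridgeAt K x → Inside G Vc C x → C ≈ K
      Inside⇒≈ C-bridge x≈K (a , b , g , x~a , _ , g∈C , between) =
        ≈-trans (EdgeAt⇒≈bridgeOf C-bridge g∈C)
                (Between⇒≈ (Star-preserves (BridgeAt K) BridgeAt-NextGb x~a x≈K) between)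

lemma6 : ∀ {n m} (G : EmbeddedGraph n m) (Vc : Subset n)
         → Connected G → Simple G → Cutset G Vc
         → ∀ (C₁ C₂ : Bridge G Vc) (x : Dart G Vc)
         → IsBridge G Vc C₁ → IsBridge G Vc C₂ → IsGb G Vc x
         → Inside G Vc C₁ x → Inside G Vc C₂ x
         → SameBridge G Vc C₁ C₂
lemma6 G Vc _ (loopless , _) _ C₁ C₂ x C₁-bridge C₂-bridge x∈Gb C₁-inside C₂-inside
  with K , x-K ← BridgeAt-exists G Vc loopless x∈Gb =
  ≈-trans G Vc (Inside⇒≈ G Vc loopless C₁-bridge x-K C₁-inside)
               (≈-sym G Vc (Inside⇒≈ G Vc loopless C₂-bridge x-K C₂-inside))
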